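{- For any digraph $D$ on $n$ vertices, if $k\geq\Delta_c(D)+2$, then $\operatorname{diam}(\mathcal{D}_k(D))\leq 4\cdot\vec{\chi}(D)\cdot n$.
   Context: For a vertex $v$ of $D$, the cycle-degree $d_c(v)$ is the minimum size of a set $S\subseteq V(D)\setminus\{v\}$ intersecting every directed cycle of $D$ containing $v$; $\Delta_c(D)=\max_v d_c(v)$. A $k$-dicolouring is a map $V(D)\to[k]$ whose colour classes induce acyclic subdigraphs; $\vec{\chi}(D)$ is the least $k$ admitting one; $\mathcal{D}_k(D)$ is the graph on $k$-dicolourings, two adjacent iff they differ on exactly one vertex. -}

module Defs where

open import Data.Nat using (ℕ; zero; suc; _≤_; _+_; _*_)
open import Data.Fin using (Fin)
open import Data.Fin.Subset using (Subset; outside; inside; ∣_∣)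
open import Data.Bool using (Bool; T)
open import Data.Vec using (lookup)
open import Data.List using (List; []; _∷_; _++_; [_])
open import Data.List.Membership.Propositional using (_∈_)
open import Data.List.Relation.Unary.Any using (Any)
open import Data.List.Relation.Unary.All using (All)
open import Data.List.Relation.Unary.Linked using (Linked)
open import Data.List.Relation.Unary.Unique.Propositional using (Unique)
open import Data.Product using (Σ; ∃; _×_; _,_)
open import Relation.Nullary using (¬_)
open import Data.Empty using (⊥)
open import Data.Sum using (_⊎_)
open import Relation.Binary.PropositionalEquality using (_≡_; _≢_)

-- A (finite, simple) digraph on vertex set Fin n: an arc relation with no loops.
-- Digons (u→v and v→u) are allowed; parallel arcs do not exist by construction.
record Digraph (n : ℕ) : Set where
  field
    adj      : Fin n → Fin n → Bool
    loopless : ∀ v → ¬ T (adj v v)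

module _ {n : ℕ} (D : Digraph n) where
  open Digraph D

  Arc : Fin n → Fin n → Set
  Arc u v = T (adj u v)

  IsDicycle : List (Fin n) → Set
  IsDicycle []       = ⊥
  IsDicycle (v ∷ vs) = Unique (v ∷ vs) × Linked Arc ((v ∷ vs) ++ [ v ])

  IsCycleTransversal : Fin n → Subset n → Set
  IsCycleTransversal v S =
    lookup S v ≡ outside ×
    (∀ C → IsDicycle C → v ∈ C → Any (λ u → lookup S u ≡ inside) C)

  IsCycleDegree : Fin n → ℕ → Set
  IsCycleDegree v d =
    (Σ (Subset n) λ S → IsCycleTransversal v S × ∣ S ∣ ≡ d) ×
    (∀ S → IsCycleTransversal v S → d ≤ ∣ S ∣)

  -- Δ_c(D) = Δ : the maximum of d_c(v) over all vertices v.
  -- (For n = 0 we take Δ_c = 0 by convention.)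
  IsMaxCycleDegree : ℕ → Set
  IsMaxCycleDegree Δ =
    (∀ v d → IsCycleDegree v d → d ≤ Δ) ×
    ((∃ λ v → IsCycleDegree v Δ) ⊎ (n ≡ 0 × Δ ≡ 0))

  -- A k-colouring is a map V(D) → [k]; it is a k-dicolouring if every colour
  -- class induces an acyclic subdigraph, i.e. no directed cycle is monochromatic.
  Colouring : ℕ → Set
  Colouring k = Fin n → Fin k

  IsDicolouring : (k : ℕ) → Colouring k → Set
  IsDicolouring k α = ∀ (c : Fin k) C → IsDicycle C → ¬ All (λ u → α u ≡ c) C

  IsDichromaticNumber : ℕ → Set
  IsDichromaticNumber χ =
    (Σ (Colouring χ) (IsDicolouring χ)) ×
    (∀ m → (α : Colouring m) → IsDicolouring m α → χ ≤ m)

  -- Adjacency in the reconfiguration graph 𝒟_k(D): differ on exactly one vertex.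
  DiffersOnOne : (k : ℕ) → Colouring k → Colouring k → Set
  DiffersOnOne k α β = ∃ λ v → α v ≢ β v × (∀ u → u ≢ v → α u ≡ β u)

  -- A walk of length ℓ in 𝒟_k(D) from α to β (all colourings on it are
  -- k-dicolourings; the endpoint α is assumed to be one).
  data Walk (k : ℕ) : Colouring k → Colouring k → ℕ → Set where
    here : ∀ {α β} → (∀ u → α u ≡ β u) → Walk k α β 0
    step : ∀ {α γ β ℓ} → DiffersOnOne k α γ → IsDicolouring k γ →
           Walk k γ β ℓ → Walk k α β (suc ℓ)

  DiamAtMost : (k : ℕ) → ℕ → Set
  DiamAtMost k L =
    ∀ (α β : Colouring k) → IsDicolouring k α → IsDicolouring k β →
    ∃ λ ℓ → ℓ ≤ L × Walk k α β ℓ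

-- Fix a χ-dicolouring γ of D, read as a k-dicolouring τ. Any k-dicolouring can be moved to τ one
-- colour class of γ at a time: to give class c its colour ι c, first recolour every vertex outside
-- class c that carries ι c (possible since k ≥ Δ_c + 2 leaves, at every vertex, a colour other
-- than ι c that is absent from a minimum cycle transversal), then recolour the vertices of class c
-- to ι c (safe, because the vertices coloured ι c now lie inside the acyclic class c). Each class
-- costs at most 2n recolourings, so every k-dicolouring is within 2χn of τ, and any two are
-- joined through τ.
module Submission where

open import Defs
open import Data.Bool.Properties using (¬-not) renaming (_≟_ to _≟ᵇ_)
open import Data.Empty using (⊥-elim)
open import Data.Fin as Fin using (Fin; inject≤)
open import Data.Fin.Properties using (_≟_; any?; ¬∀⟶∃¬; injective⇒≤; inject≤-injective)
open import Data.Fin.Subset using (Subset; inside; outside; ∣_∣; ⁅_⁆; ∁)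
open import Data.Fin.Subset.Properties using (anySubset?; x∈⁅x⁆; x∈⁅y⁆⇒x≡y; x∈p⇒x∉∁p; x∉p⇒x∈∁p)
open import Data.List as List using (List; []; _∷_; _++_; [_]; length; map; allFin)
open import Data.List.Properties using (length-map; length-tabulate)
open import Data.List.Membership.Propositional using (_∈_; _∉_)
open import Data.List.Membership.Propositional.Properties using (∈-allFin; ∈-map⁺; ∈-lookup)
open import Data.List.Relation.Unary.Any as Any using (Any; here; there)
open import Data.List.Relation.Unary.Any.Properties using (lookup-index)
open import Data.List.Relation.Unary.All as All using (All; _∷_)
open import Data.List.Relation.Unary.AllPairs using (_∷_; allPairs?)
open import Data.List.Relation.Unary.Linked using ([-]; _∷_; linked?)
open import Data.List.Relation.Unary.Unique.Propositional using (Unique)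
open import Data.Nat using (ℕ; zero; suc; _≤_; _<_; _+_; _*_; z≤n; s≤s) renaming (_≟_ to _≟ℕ_)
open import Data.Nat.Induction using (<-rec)
open import Data.Nat.Properties using (≤-refl; ≤-trans; ≤-reflexive; +-comm; +-mono-≤; +-monoʳ-≤; <⇒≱; ≮⇒≥; anyUpTo?)
open import Data.Nat.Tactic.RingSolver using (solve-∀)
open import Data.Product using (∃; _×_; _,_)
open import Data.Vec using (lookup; []; _∷_)
open import Data.Vec.Properties using ([]=⇒lookup; lookup⇒[]=)
open import Data.Vec.Functional using (updateAt)
open import Data.Vec.Functional.Properties using (updateAt-updates; updateAt-minimal; updateAt-id-local)
open import Function using (id; const; _∘_)
open import Function.Definitions using (Injective)
open import Relation.Nullary using (¬_; Dec; yes; no; ¬?)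
open import Relation.Nullary.Decidable using (_×-dec_; map′; decidable-stable; T?)
open import Relation.Unary using (Decidable)
open import Relation.Binary.PropositionalEquality using (_≡_; _≢_; _≗_; refl; sym; trans; cong; subst)

_∈?_ : ∀ {n} (x : Fin n) (xs : List (Fin n)) → Dec (x ∈ xs)
x ∈? xs = Any.any? (x ≟_) xs

unique⇒lookup-injective : ∀ {A : Set} {xs : List A} → Unique xs → Injective _≡_ _≡_ (List.lookup xs)
unique⇒lookup-injective (_ ∷ _) {Fin.zero} {Fin.zero} _ = refl
unique⇒lookup-injective (x∉xs ∷ _) {Fin.zero} {Fin.suc j} eq = ⊥-elim (All.lookup x∉xs (∈-lookup j) eq)
unique⇒lookup-injective (x∉xs ∷ _) {Fin.suc i} {Fin.zero} eq = ⊥-elim (All.lookup x∉xs (∈-lookup i) (sym eq))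
unique⇒lookup-injective (_ ∷ u) {Fin.suc i} {Fin.suc j} eq = cong Fin.suc (unique⇒lookup-injective u eq)

unique⇒length≤ : ∀ {n} {xs : List (Fin n)} → Unique xs → length xs ≤ n
unique⇒length≤ u = injective⇒≤ (unique⇒lookup-injective u)

length<⇒∃∉ : ∀ {k} (cs : List (Fin k)) → length cs < k → ∃ λ c → c ∉ cs
length<⇒∃∉ cs len<k = ¬∀⟶∃¬ _ (_∈ cs) (_∈? cs) λ all∈ → <⇒≱ len<k (injective⇒≤ (index-injective all∈))
  where
    index-injective : (all∈ : ∀ c → c ∈ cs) → Injective _≡_ _≡_ (λ c → Any.index (all∈ c))
    index-injective all∈ {c} {d} eq =
      trans (lookup-index (all∈ c)) (trans (cong (List.lookup cs) eq) (sym (lookup-index (all∈ d))))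

anyList≤? : ∀ {n} {P : List (Fin n) → Set} → Decidable P → ∀ m → Dec (∃ λ xs → length xs ≤ m × P xs)
anyList≤? P? m with P? []
... | yes p = yes ([] , z≤n , p)
anyList≤? P? zero | no ¬p = no λ { ([] , _ , p) → ¬p p ; (_ ∷ _ , () , _) }
anyList≤? P? (suc m) | no ¬p with any? (λ x → anyList≤? (P? ∘ (x ∷_)) m)
... | yes (x , xs , len≤ , p) = yes (x ∷ xs , s≤s len≤ , p)
... | no ¬q = no λ { ([] , _ , p) → ¬p p ; (x ∷ xs , s≤s len≤ , p) → ¬q (x , xs , len≤ , p) }

Least : (ℕ → Set) → ℕ → Set
Least P d = P d × (∀ {d′} → P d′ → d ≤ d′)

least : ∀ {P : ℕ → Set} → Decidable P → ∀ {m} → P m → ∃ (Least P)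
least {P} P? = <-rec (λ m → P m → ∃ (Least P)) descend _
  where
    descend : ∀ m → (∀ {m′} → m′ < m → P m′ → ∃ (Least P)) → P m → ∃ (Least P)
    descend m below pm with anyUpTo? P? m
    ... | yes (m′ , m′<m , pm′) = below m′<m pm′
    ... | no none = m , pm , λ {d′} pd′ → ≮⇒≥ λ d′<m → none (d′ , d′<m , pd′)

members : ∀ {n} → Subset n → List (Fin n)
members [] = []
members (inside ∷ p) = Fin.zero ∷ map Fin.suc (members p)
members (outside ∷ p) = map Fin.suc (members p)

length-members : ∀ {n} (p : Subset n) → length (members p) ≡ ∣ p ∣
length-members [] = refl
length-members (inside ∷ p) = cong suc (trans (length-map Fin.suc (members p)) (length-members p))
length-members (outside ∷ p) = trans (length-map Fin.suc (members p)) (length-members p)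

∈-members : ∀ {n} (p : Subset n) {u} → lookup p u ≡ inside → u ∈ members p
∈-members (inside ∷ p) {Fin.zero} _ = here refl
∈-members (inside ∷ p) {Fin.suc u} u∈p = there (∈-map⁺ Fin.suc (∈-members p u∈p))
∈-members (outside ∷ p) {Fin.suc u} u∈p = ∈-map⁺ Fin.suc (∈-members p u∈p)

∃unusedColour : ∀ {n k} (S : Subset n) → 2 + ∣ S ∣ ≤ k → (α : Fin n → Fin k) (c : Fin k) →
                ∃ λ c′ → c′ ≢ c × (∀ u → lookup S u ≡ inside → α u ≢ c′)
∃unusedColour S 2+∣S∣≤k α c with length<⇒∃∉ (c ∷ map α (members S)) length<k
  where
    length<k : suc (length (map α (members S))) < _
    length<k = subst (λ l → suc (suc l) ≤ _) (sym (trans (length-map α (members S)) (length-members S))) 2+∣S∣≤k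
... | c′ , c′∉ = c′ , (λ c′≡c → c′∉ (here c′≡c)) ,
      λ u u∈S αu≡c′ → c′∉ (there (subst (_∈ _) αu≡c′ (∈-map⁺ α (∈-members S u∈S))))

_[_≔_] : ∀ {n} {A : Set} → (Fin n → A) → Fin n → A → Fin n → A
α [ x ≔ c ] = updateAt α x (const c)

AgreeOff : ∀ {n} {A : Set} → Fin n → (Fin n → A) → (Fin n → A) → Set
AgreeOff x α β = ∀ y → y ≢ x → β y ≡ α y

agreeOff-pointwise : ∀ {n} {A : Set} {Φ : Fin n → A → Set} {α β : Fin n → A} x →
                     AgreeOff x α β → (∀ y → Φ y (α y)) → Φ x (β x) → ∀ y → Φ y (β y)
agreeOff-pointwise {Φ = Φ} x agree all Φx y with y ≟ x
... | yes refl = Φx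
... | no y≢x = subst (Φ y) (sym (agree y y≢x)) (all y)

module CycleDegree {n : ℕ} (D : Digraph n) where
  open Digraph D

  dicycle? : Decidable (IsDicycle D)
  dicycle? [] = no λ ()
  dicycle? (v ∷ vs) = allPairs? (λ x y → ¬? (x ≟ y)) (v ∷ vs) ×-dec linked? (λ x y → T? (adj x y)) ((v ∷ vs) ++ [ v ])

  dicycle-length≤ : ∀ {C} → IsDicycle D C → length C ≤ n
  dicycle-length≤ {_ ∷ _} (unique , _) = unique⇒length≤ unique

  dicycle-∃≢ : ∀ {C} → IsDicycle D C → ∀ v → Any (_≢ v) C
  dicycle-∃≢ {w ∷ []} (_ , (w→w ∷ [-])) v = ⊥-elim (loopless w w→w)
  dicycle-∃≢ {w ∷ x ∷ _} (((w≢x ∷ _) ∷ _) , _) v with w ≟ v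
  ... | no w≢v = here w≢v
  ... | yes refl = there (here (w≢x ∘ sym))

  transversal? : ∀ v S → Dec (IsCycleTransversal D v S)
  transversal? v S = (lookup S v ≟ᵇ outside) ×-dec map′ meets avoids (¬? avoiding?)
    where
      Hit : Fin n → Set
      Hit u = lookup S u ≡ inside

      hits? : Decidable (Any Hit)
      hits? = Any.any? (λ u → lookup S u ≟ᵇ inside)

      AvoidingDicycle : Set
      AvoidingDicycle = ∃ λ C → length C ≤ n × IsDicycle D C × v ∈ C × ¬ Any Hit C

      avoiding? : Dec AvoidingDicycle
      avoiding? = anyList≤? (λ C → dicycle? C ×-dec (v ∈? C) ×-dec ¬? (hits? C)) n

      meets : ¬ AvoidingDicycle → ∀ C → IsDicycle D C → v ∈ C → Any Hit C
      meets none C dc v∈C = decidable-stable (hits? C) λ ¬hit → none (C , dicycle-length≤ dc , dc , v∈C , ¬hit)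

      avoids : (∀ C → IsDicycle D C → v ∈ C → Any Hit C) → ¬ AvoidingDicycle
      avoids hits (C , _ , dc , v∈C , ¬hit) = ¬hit (hits C dc v∈C)

  all-but-transversal : ∀ v → IsCycleTransversal D v (∁ ⁅ v ⁆)
  all-but-transversal v = v∉ , λ C dc _ → Any.map others (dicycle-∃≢ dc v)
    where
      v∉ : lookup (∁ ⁅ v ⁆) v ≡ outside
      v∉ = ¬-not λ v∈ → x∈p⇒x∉∁p (x∈⁅x⁆ v) (lookup⇒[]= v _ v∈)

      others : ∀ {u} → u ≢ v → lookup (∁ ⁅ v ⁆) u ≡ inside
      others u≢v = []=⇒lookup (x∉p⇒x∈∁p (u≢v ∘ x∈⁅y⁆⇒x≡y v))

  cycleDegree : ∀ v → ∃ (IsCycleDegree D v)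
  cycleDegree v with least size? (∁ ⁅ v ⁆ , all-but-transversal v , refl)
    where
      size? : ∀ d → Dec (∃ λ S → IsCycleTransversal D v S × ∣ S ∣ ≡ d)
      size? d = anySubset? λ S → transversal? v S ×-dec (∣ S ∣ ≟ℕ d)
  ... | d , attained , minimal = d , attained , λ S t → minimal (S , t , refl)

  small-transversal : ∀ {Δ} → IsMaxCycleDegree D Δ → ∀ v → ∃ λ S → IsCycleTransversal D v S × ∣ S ∣ ≤ Δ
  small-transversal (maximal , _) v with cycleDegree v
  ... | d , deg@((S , t , ∣S∣≡d) , _) = S , t , ≤-trans (≤-reflexive ∣S∣≡d) (maximal v d deg)

module Reconfiguration {n : ℕ} (D : Digraph n) (k : ℕ) where

  _⇝[_]_ : Colouring D k → ℕ → Colouring D k → Set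
  α ⇝[ L ] β = ∃ λ ℓ → ℓ ≤ L × Walk D k α β ℓ

  private
    differs-sym : ∀ {α β} → DiffersOnOne D k α β → DiffersOnOne D k β α
    differs-sym (v , αv≢βv , agree) = v , αv≢βv ∘ sym , λ u u≢v → sym (agree u u≢v)

    differs-respˡ : ∀ {α α′ β} → α ≗ α′ → DiffersOnOne D k α β → DiffersOnOne D k α′ β
    differs-respˡ α≗α′ (v , αv≢βv , agree) = v , αv≢βv ∘ trans (α≗α′ v) , λ u u≢v → trans (sym (α≗α′ u)) (agree u u≢v)

    walk-respˡ : ∀ {α α′ β ℓ} → α ≗ α′ → Walk D k α′ β ℓ → Walk D k α β ℓ
    walk-respˡ α≗α′ (here α′≗β) = here λ u → trans (α≗α′ u) (α′≗β u)
    walk-respˡ α≗α′ (step d dγ w) = step (differs-respˡ (sym ∘ α≗α′) d) dγ w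

    walk-++ : ∀ {α β γ ℓ₁ ℓ₂} → Walk D k α β ℓ₁ → Walk D k β γ ℓ₂ → Walk D k α γ (ℓ₁ + ℓ₂)
    walk-++ (here α≗β) w = walk-respˡ α≗β w
    walk-++ (step d dγ w₁) w₂ = step d dγ (walk-++ w₁ w₂)

    walk-snoc : ∀ {α β γ ℓ} → Walk D k α β ℓ → DiffersOnOne D k β γ → IsDicolouring D k γ → Walk D k α γ (suc ℓ)
    walk-snoc (here α≗β) d dγ = step (differs-respˡ (sym ∘ α≗β) d) dγ (here λ _ → refl)
    walk-snoc (step d′ dδ w) d dγ = step d′ dδ (walk-snoc w d dγ)

    walk-reverse : ∀ {α β ℓ} → IsDicolouring D k α → Walk D k α β ℓ → Walk D k β α ℓ
    walk-reverse dα (here α≗β) = here (sym ∘ α≗β)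
    walk-reverse dα (step d dγ w) = walk-snoc (walk-reverse dγ w) (differs-sym d) dα

  ⇝-refl : ∀ {α β} → α ≗ β → α ⇝[ 0 ] β
  ⇝-refl α≗β = 0 , z≤n , here α≗β

  ⇝-trans : ∀ {α β γ L M} → α ⇝[ L ] β → β ⇝[ M ] γ → α ⇝[ L + M ] γ
  ⇝-trans (ℓ₁ , ℓ₁≤L , w₁) (ℓ₂ , ℓ₂≤M , w₂) = ℓ₁ + ℓ₂ , +-mono-≤ ℓ₁≤L ℓ₂≤M , walk-++ w₁ w₂

  ⇝-sym : ∀ {α β L} → IsDicolouring D k α → α ⇝[ L ] β → β ⇝[ L ] α
  ⇝-sym dα (ℓ , ℓ≤L , w) = ℓ , ℓ≤L , walk-reverse dα w

  ⇝-weaken : ∀ {α β L M} → L ≤ M → α ⇝[ L ] β → α ⇝[ M ] β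
  ⇝-weaken L≤M (ℓ , ℓ≤L , w) = ℓ , ≤-trans ℓ≤L L≤M , w

  Monochromatic : Colouring D k → Fin k → List (Fin n) → Set
  Monochromatic α c C = All (λ u → α u ≡ c) C

  -- Only dicycles through x can become monochromatic, and only in the new colour of x.
  recolour-isDicolouring : ∀ {α x c} → IsDicolouring D k α →
                           (∀ C → IsDicycle D C → x ∈ C → ¬ Monochromatic (α [ x ≔ c ]) c C) →
                           IsDicolouring D k (α [ x ≔ c ])
  recolour-isDicolouring {α} {x} {c} dα safe c′ C dc mono with x ∈? C
  ... | no x∉C = dα c′ C dc (All.tabulate λ {u} u∈C →
                   trans (sym (updateAt-minimal u x α λ { refl → x∉C u∈C })) (All.lookup mono u∈C))
  ... | yes x∈C = safe C dc x∈C (subst (λ c″ → Monochromatic (α [ x ≔ c ]) c″ C) c′≡c mono)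
    where
      c′≡c : c′ ≡ c
      c′≡c = trans (sym (All.lookup mono x∈C)) (updateAt-updates x α)

  RecolouredAt : Fin n → Colouring D k → Colouring D k → Set
  RecolouredAt x α β = AgreeOff x α β × α ⇝[ 1 ] β

  stay : ∀ {x α} → RecolouredAt x α α
  stay = (λ _ _ → refl) , ⇝-weaken z≤n (⇝-refl λ _ → refl)

  recolour : ∀ {α x c} → IsDicolouring D k (α [ x ≔ c ]) → RecolouredAt x α (α [ x ≔ c ])
  recolour {α} {x} {c} dα′ = (λ y y≢x → updateAt-minimal y x α y≢x) , move
    where
      move : α ⇝[ 1 ] (α [ x ≔ c ])
      move with α x ≟ c
      ... | yes αx≡c = ⇝-weaken z≤n (⇝-refl (sym ∘ updateAt-id-local x α (sym αx≡c)))
      ... | no αx≢c = 1 , ≤-refl ,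
            step (x , (λ αx≡ → αx≢c (trans αx≡ (updateAt-updates x α))) , λ u u≢x → sym (updateAt-minimal u x α u≢x))
                 dα′ (here λ _ → refl)

  sweep : (Q : Colouring D k → Set) (P : Fin n → Fin k → Set) →
          (∀ x {α} → Q α → ∃ λ β → Q β × P x (β x) × RecolouredAt x α β) →
          ∀ {α} → Q α → ∃ λ β → Q β × (∀ y → P y (β y)) × α ⇝[ n ] β
  sweep Q P fix qα with sweepList (allFin n) qα
    where
      sweepList : ∀ xs {α} → Q α → ∃ λ β → Q β × (∀ y → y ∈ xs → P y (β y)) × α ⇝[ length xs ] β
      sweepList [] qα = _ , qα , (λ _ ()) , ⇝-refl λ _ → refl
      sweepList (x ∷ xs) qα with sweepList xs qα
      ... | γ , qγ , done , α⇝γ with fix x qγ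
      ... | β , qβ , px , agree , γ⇝β =
        β , qβ , done′ , ⇝-weaken (≤-reflexive (+-comm (length xs) 1)) (⇝-trans α⇝γ γ⇝β)
        where
          done′ : ∀ y → y ∈ x ∷ xs → P y (β y)
          done′ y (here refl) = px
          done′ y (there y∈xs) = agreeOff-pointwise {Φ = λ y a → y ∈ xs → P y a} x agree done (λ _ → px) y y∈xs
  ... | β , qβ , done , α⇝β =
    β , qβ , (λ y → done y (∈-allFin y)) , ⇝-weaken (≤-reflexive (length-tabulate id)) α⇝β

  SpareColour : Set
  SpareColour = ∀ {α} → IsDicolouring D k α → ∀ x c → ∃ λ c′ → c′ ≢ c × IsDicolouring D k (α [ x ≔ c′ ])

  recolour-avoiding-transversal : ∀ {α x S c} → IsDicolouring D k α → IsCycleTransversal D x S →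
                                  (∀ u → lookup S u ≡ inside → α u ≢ c) → IsDicolouring D k (α [ x ≔ c ])
  recolour-avoiding-transversal {α} {x} {S} {c} dα (x∉S , hits) unused = recolour-isDicolouring dα safe
    where
      safe : ∀ C → IsDicycle D C → x ∈ C → ¬ Monochromatic (α [ x ≔ c ]) c C
      safe C dc x∈C mono with All.lookupAny mono (hits C dc x∈C)
      ... | α′u≡c , u∈S = unused _ u∈S (trans (sym (updateAt-minimal _ x α u≢x)) α′u≡c)
        where
          u≢x : Any.lookup (hits C dc x∈C) ≢ x
          u≢x u≡x with trans (sym u∈S) (trans (cong (lookup S) u≡x) x∉S)
          ... | ()

  spareColour : ∀ {Δ} → IsMaxCycleDegree D Δ → Δ + 2 ≤ k → SpareColour
  spareColour {Δ} hΔ Δ+2≤k {α} dα x c with CycleDegree.small-transversal D hΔ x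
  ... | S , t , ∣S∣≤Δ with ∃unusedColour S 2+∣S∣≤k α c
    where
      2+∣S∣≤k : 2 + ∣ S ∣ ≤ k
      2+∣S∣≤k = ≤-trans (+-monoʳ-≤ 2 ∣S∣≤Δ) (subst (_≤ k) (+-comm Δ 2) Δ+2≤k)
  ... | c′ , c′≢c , unused = c′ , c′≢c , recolour-avoiding-transversal {S = S} dα t unused

module Normalisation {n : ℕ} (D : Digraph n) {k χ : ℕ} (γ : Colouring D χ) (dγ : IsDicolouring D χ γ)
                 (χ≤k : χ ≤ k) (spare : Reconfiguration.SpareColour D k) where
  open Reconfiguration D k

  ι : Fin χ → Fin k
  ι c = inject≤ c χ≤k

  τ : Colouring D k
  τ = ι ∘ γ

  Canonical : List (Fin χ) → Fin n → Fin k → Set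
  Canonical cs w a = γ w ∈ cs → a ≡ τ w

  Fixed : List (Fin χ) → Colouring D k → Set
  Fixed cs α = ∀ w → Canonical cs w (α w)

  module _ (c : Fin χ) (cs : List (Fin χ)) where

    OnlyInClass : Fin n → Fin k → Set
    OnlyInClass w a = a ≡ ι c → γ w ≡ c

    ClassColoured : Fin n → Fin k → Set
    ClassColoured w a = γ w ≡ c → a ≡ ι c

    Clearing : Colouring D k → Set
    Clearing α = IsDicolouring D k α × Fixed cs α

    Setting : Colouring D k → Set
    Setting α = Clearing α × (∀ w → OnlyInClass w (α w))

    clear-step : ∀ x {α} → Clearing α → ∃ λ β → Clearing β × OnlyInClass x (β x) × RecolouredAt x α β
    clear-step x {α} (dα , fixed) with α x ≟ ι c
    ... | no αx≢ιc = α , (dα , fixed) , (λ αx≡ιc → ⊥-elim (αx≢ιc αx≡ιc)) , stay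
    ... | yes αx≡ιc with γ x ≟ c
    ...   | yes γx≡c = α , (dα , fixed) , (λ _ → γx≡c) , stay
    ...   | no γx≢c with spare dα x (ι c)
    ...     | c′ , c′≢ιc , dα′ with recolour dα′
    ...       | moved@(agree , _) = α [ x ≔ c′ ] , (dα′ , fixed′) , c′-fresh , moved
      where
        c′-fresh : OnlyInClass x ((α [ x ≔ c′ ]) x)
        c′-fresh α′x≡ιc = ⊥-elim (c′≢ιc (trans (sym (updateAt-updates x α)) α′x≡ιc))

        fixed′ : Fixed cs (α [ x ≔ c′ ])
        fixed′ = agreeOff-pointwise {Φ = Canonical cs} x agree fixed
                   λ γx∈cs → ⊥-elim (γx≢c (inject≤-injective χ≤k χ≤k _ _ (trans (sym (fixed x γx∈cs)) αx≡ιc)))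

    set-step : ∀ x {α} → Setting α → ∃ λ β → Setting β × ClassColoured x (β x) × RecolouredAt x α β
    set-step x {α} ((dα , fixed) , confined) with γ x ≟ c
    ... | no γx≢c = α , ((dα , fixed) , confined) , (λ γx≡c → ⊥-elim (γx≢c γx≡c)) , stay
    ... | yes γx≡c = α′ , ((dα′ , fixed′) , confined′) , (λ _ → updateAt-updates x α) , recolour dα′
      where
        α′ : Colouring D k
        α′ = α [ x ≔ ι c ]

        agree : AgreeOff x α α′
        agree y y≢x = updateAt-minimal y x α y≢x

        confined′ : ∀ w → OnlyInClass w (α′ w)
        confined′ = agreeOff-pointwise {Φ = OnlyInClass} x agree confined λ _ → γx≡c

        fixed′ : Fixed cs α′
        fixed′ = agreeOff-pointwise {Φ = Canonical cs} x agree fixed λ _ → trans (updateAt-updates x α) (cong ι (sym γx≡c))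

        -- A monochromatic dicycle in colour ι c would lie inside the acyclic class c of γ.
        dα′ : IsDicolouring D k α′
        dα′ = recolour-isDicolouring dα λ C dc _ mono → dγ c C dc (All.map (λ {w} → confined′ w) mono)

    fix-class : ∀ {α} → IsDicolouring D k α → Fixed cs α →
                ∃ λ β → IsDicolouring D k β × Fixed (c ∷ cs) β × α ⇝[ n + n ] β
    fix-class dα fixed with sweep Clearing OnlyInClass clear-step (dα , fixed)
    ... | α₁ , cleared , confined₁ , α⇝α₁ with sweep Setting ClassColoured set-step (cleared , confined₁)
    ... | α₂ , ((dα₂ , fixed₂) , _) , coloured₂ , α₁⇝α₂ = α₂ , dα₂ , fixed′ , ⇝-trans α⇝α₁ α₁⇝α₂
      where
        fixed′ : Fixed (c ∷ cs) α₂
        fixed′ w (here γw≡c) = trans (coloured₂ w γw≡c) (cong ι (sym γw≡c))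
        fixed′ w (there γw∈cs) = fixed₂ w γw∈cs

  fix-classes : ∀ cs {α} → IsDicolouring D k α →
                ∃ λ β → IsDicolouring D k β × Fixed cs β × α ⇝[ length cs * (n + n) ] β
  fix-classes [] dα = _ , dα , (λ _ ()) , ⇝-refl λ _ → refl
  fix-classes (c ∷ cs) dα with fix-classes cs dα
  ... | β , dβ , fixed , α⇝β with fix-class c cs dβ fixed
  ... | β′ , dβ′ , fixed′ , β⇝β′ =
    β′ , dβ′ , fixed′ , ⇝-weaken (≤-reflexive (+-comm (length cs * (n + n)) (n + n))) (⇝-trans α⇝β β⇝β′)

  ⇝τ : ∀ {α} → IsDicolouring D k α → α ⇝[ χ * (n + n) ] τ
  ⇝τ dα with fix-classes (allFin χ) dα
  ... | β , _ , fixed , α⇝β = ⇝-weaken bound (⇝-trans α⇝β (⇝-refl λ w → fixed w (∈-allFin (γ w))))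
    where
      bound : length (allFin χ) * (n + n) + 0 ≤ χ * (n + n)
      bound = ≤-reflexive (trans (+-comm _ 0) (cong (_* (n + n)) (length-tabulate {n = χ} id)))

corollary16 : ∀ (n : ℕ) (D : Digraph n) (Δ χ k : ℕ) →
    IsMaxCycleDegree D Δ → IsDichromaticNumber D χ → Δ + 2 ≤ k →
    DiamAtMost D k (4 * χ * n)
corollary16 n D Δ χ k hΔ ((γ , dγ) , minimal) Δ+2≤k α β dα dβ =
  ⇝-weaken (≤-reflexive (twice χ n)) (⇝-trans (⇝τ dα) (⇝-sym dβ (⇝τ dβ)))
  where
    open Reconfiguration D k
    open Normalisation D γ dγ (minimal k α dα) (spareColour hΔ Δ+2≤k)

    twice : ∀ χ n → χ * (n + n) + χ * (n + n) ≡ 4 * χ * n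
    twice = solve-∀
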